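{- Let $D$ be a finite digraph without sources or sinks and let $n\ge 1$. Then $D$ is an $n$th-order line digraph if and only if, for every $1\le i\le n$ and every $i$th-order coreset $U$ of $D$, for each vertex $u\in U$ and each vertex $v\in\alpha^i(U)$ there is exactly one walk of length $i$ in $D$ from $u$ to $v$.
   Context: Digraphs are finite; loops allowed, no multiple edges unless stated. A sink is a vertex with no successors, a source a vertex with no predecessors. For a digraph $D'$ (loops and multiple edges allowed), the line digraph $L(D')$ is the digraph without multiple edges with vertex set $E(D')$ and an edge from $e$ to $f$ iff the head of $e$ is the tail of $f$; $L^1=L$ and $L^n(D')=L(L^{n-1}(D'))$. $D$ is an $n$th-order line digraph if $D\cong L^n(D')$ for some digraph $D'$ (loops and multiple edges allowed). A walk of length $i$ from $u$ to $v$ is a sequence $u=v_0,\ldots,v_i=v$ with $v_{k-1}v_k\in E(D)$ for each $k$. For $S\subseteq V(D)$, $\alpha^i(S)$ is the set of vertices reachable by a walk of length $i$ from a vertex of $S$, and $\beta^i(S)$ the set of vertices from which a vertex of $S$ is reachable by a walk of length $i$. The $i$th-order coresets of $D$ (for $D$ without sources or sinks) are the minimal nonempty sets $U\subseteq V(D)$ with $\beta^i(\alpha^i(U))=U$; equivalently, the coresets of the digraph $D^i$ on $V(D)$ whose edges $uv$ are the pairs joined by a walk of length $i$ in $D$. -}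

module Defs where

open import Level using (0ℓ)
open import Data.Nat using (ℕ; zero; suc)
open import Data.Fin using (Fin)
open import Data.Bool using (Bool; T)
open import Data.Product using (Σ; ∃; _×_; _,_)
open import Relation.Binary.PropositionalEquality using (_≡_)
open import Relation.Unary using (Pred; Satisfiable; _⊆_; _≐_)
open import Function.Bundles using (_⤖_; Bijection; _⇔_)

-- Finite (simple) digraphs: vertex set Fin m, loops allowed, no
-- multiple edges; the edge relation is a Bool-valued adjacency.

record Digraph : Set where
  field
    size : ℕ
    adj  : Fin size → Fin size → Bool

module _ (D : Digraph) where
  open Digraph D

  Vertex : Set
  Vertex = Fin size

  Edge : Vertex → Vertex → Set
  Edge u v = T (adj u v)

  NoSources : Set
  NoSources = ∀ v → ∃ λ u → Edge u v

  NoSinks : Set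
  NoSinks = ∀ u → ∃ λ v → Edge u v

  -- walks of length i from u to v (determined by their vertex sequence,
  -- since edge proofs live in T _, which has at most one element)
  data Walk : ℕ → Vertex → Vertex → Set where
    nil  : ∀ {u} → Walk zero u u
    cons : ∀ {i u w v} → Edge u w → Walk i w v → Walk (suc i) u v

  α : ℕ → Pred Vertex 0ℓ → Pred Vertex 0ℓ
  α i S v = ∃ λ u → S u × Walk i u v

  β : ℕ → Pred Vertex 0ℓ → Pred Vertex 0ℓ
  β i S u = ∃ λ v → S v × Walk i u v

  Closed : ℕ → Pred Vertex 0ℓ → Set
  Closed i U = β i (α i U) ≐ U

  IsCoreset : ℕ → Pred Vertex 0ℓ → Set₁
  IsCoreset i U =
    Satisfiable U × Closed i U ×
    (∀ (U' : Pred Vertex 0ℓ) → Satisfiable U' → U' ⊆ U → Closed i U' → U ⊆ U')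

  UniqueWalk : ℕ → Vertex → Vertex → Set
  UniqueWalk i u v = Σ (Walk i u v) λ w → ∀ (w' : Walk i u v) → w' ≡ w

record MDigraph : Set₁ where
  field
    V    : Set
    E    : Set
    tail : E → V
    head : E → V

finMDigraph : (p q : ℕ) → (Fin q → Fin p) → (Fin q → Fin p) → MDigraph
finMDigraph p q t h = record { V = Fin p ; E = Fin q ; tail = t ; head = h }

L : MDigraph → MDigraph
L G = record
  { V    = E
  ; E    = Σ (E × E) (λ { (e , f) → head e ≡ tail f })
  ; tail = λ { ((e , f) , _) → e }
  ; head = λ { ((e , f) , _) → f }
  }
  where open MDigraph G

L^ : ℕ → MDigraph → MDigraph
L^ zero    G = G
L^ (suc n) G = L (L^ n G)

-- isomorphism of a simple digraph D with a multidigraph G (used only for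
-- G without multiple edges): a vertex bijection such that u → v in D iff
-- there is an edge φ u → φ v in G
_≅_ : Digraph → MDigraph → Set
D ≅ G = Σ (Vertex D ⤖ MDigraph.V G) λ φ →
  ∀ u v → Edge D u v ⇔ (∃ λ (e : MDigraph.E G) →
            (MDigraph.tail G e ≡ Bijection.to φ u) × (MDigraph.head G e ≡ Bijection.to φ v))

IsLineDigraph : ℕ → Digraph → Set
IsLineDigraph n D =
  ∃ λ p → ∃ λ q → ∃ λ (t : Fin q → Fin p) → ∃ λ (h : Fin q → Fin p) →
    D ≅ L^ n (finMDigraph p q t h)

-- If D ≅ L^(k+1) G, a vertex of D is a walk of k + 1 edges of G, and a walk of length i in D shifts
-- such a walk by i positions. The i-th order coresets are the classes of the equivalence Linked i
-- generated by "having a common i-step successor"; linked vertices therefore share all but the first i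
-- edges, so walks of length i ≤ k + 1 from them exist together and are unique.
-- Conversely, under uniqueness Linked i is decidable and one step of it already suffices. Take the
-- classes of Linked (k + 1) as vertices of G and representatives of the classes of Linked k as its
-- edges, a representative e running from the class of a predecessor of e to the class of e. The
-- vertex u of D then corresponds to the walk formed by the representatives of its k-th, ..., first
-- predecessor and of u itself; uniqueness of walks of length k + 1 makes this correspondence bijective.

module Submission where

open import Defs
open import Level using (0ℓ)
open import Axiom.UniquenessOfIdentityProofs.WithK using (uip)
open import Data.Bool.Properties using (T-irrelevant)
open import Data.Empty using (⊥-elim)
open import Data.Fin using (Fin; join; splitAt)
open import Data.Fin.Properties using (any?; splitAt-join) renaming (_≟_ to _≟ᶠ_)
open import Data.List using ([]; _∷_; allFin; find)
open import Data.List.Membership.Propositional using (_∈_)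
open import Data.List.Membership.Propositional.Properties using (∈-allFin)
open import Data.List.Relation.Unary.Any using (here; there)
open import Data.Maybe using (just; nothing; fromMaybe)
open import Data.Nat using (ℕ; zero; suc; _+_; _∸_; _≤_; _<_; z≤n; s≤s; _≤?_)
open import Data.Nat.Properties
  using (≤-refl; ≤-trans; ≤-reflexive; <⇒≤; n≤1+n; ≤-pred; 1+n≰n; m≤n⇒m<n∨m≡n; m≤m+n; m≤n+m; m∸n≤m;
         +-identityʳ; +-comm; +-suc; +-monoʳ-≤; m+n∸m≡n; m+[n∸m]≡n; n∸n≡0; +-∸-assoc)
open import Data.Product using (Σ; ∃; _×_; _,_; proj₁; proj₂)
open import Data.Sum using (_⊎_; inj₁; inj₂; map₂)
open import Data.Sum.Properties using (inj₁-injective)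
open import Function using (id; _∘_)
open import Function.Bundles using (_⇔_; mk⇔; Equivalence; Bijection; mk⤖)
open import Relation.Nullary using (Dec; yes; no; ¬_)
open import Relation.Nullary.Decidable using (map′; _×-dec_; T?)
open import Relation.Unary using (Pred; Decidable; Satisfiable; _⊆_)
open import Relation.Binary using (Rel; IsDecEquivalence)
open import Relation.Binary.PropositionalEquality using (_≡_; _≢_; refl; sym; trans; cong; subst; subst₂)
open import Relation.Binary.Construct.Closure.ReflexiveTransitive using (Star; ε; _◅_; _◅◅_; reverse; return; gmap)

module _ {A : Set} {P : Pred A 0ℓ} (P? : Decidable P) where

  find-just : ∀ xs {y} → find P? xs ≡ just y → P y
  find-just (x ∷ xs) eq with P? x
  find-just (x ∷ xs) refl | yes px = px
  ... | no _ = find-just xs eq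

  find-nothing : ∀ xs → find P? xs ≡ nothing → ∀ {x} → x ∈ xs → ¬ P x
  find-nothing (y ∷ ys) eq x∈ with P? y
  find-nothing (y ∷ ys) eq (here refl)  | no ¬py = ¬py
  find-nothing (y ∷ ys) eq (there x∈ys) | no _   = find-nothing ys eq x∈ys

  find-cong : ∀ {Q : Pred A 0ℓ} (Q? : Decidable Q) → (∀ x → P x ⇔ Q x) → ∀ xs → find P? xs ≡ find Q? xs
  find-cong Q? P⇔Q []       = refl
  find-cong Q? P⇔Q (x ∷ xs) with P? x | Q? x
  ... | yes _  | yes _  = refl
  ... | no  _  | no  _  = find-cong Q? P⇔Q xs
  ... | yes px | no ¬qx = ⊥-elim (¬qx (Equivalence.to (P⇔Q x) px))
  ... | no ¬px | yes qx = ⊥-elim (¬px (Equivalence.from (P⇔Q x) qx))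

module Canonical {m : ℕ} {_~_ : Rel (Fin m) 0ℓ} (isDecEquivalence : IsDecEquivalence _~_) where
  open IsDecEquivalence isDecEquivalence renaming (_≟_ to _~?_; refl to ~-refl; sym to ~-sym; trans to ~-trans)

  opaque
    canon : Fin m → Fin m
    canon x = fromMaybe x (find (_~? x) (allFin m))

    canon-~ : ∀ x → canon x ~ x
    canon-~ x with find (_~? x) (allFin m) in eq
    ... | just y  = find-just (_~? x) (allFin m) eq
    ... | nothing = ~-refl

    canon-cong : ∀ {x y} → x ~ y → canon x ≡ canon y
    canon-cong {x} {y} x~y =
      trans (cong (fromMaybe x) (find-cong (_~? x) (_~? y) same-class (allFin m)))
            (found (find (_~? y) (allFin m)) (λ eq → find-nothing (_~? y) (allFin m) eq (∈-allFin y) ~-refl))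
      where
        same-class : ∀ z → z ~ x ⇔ z ~ y
        same-class z = mk⇔ (λ z~x → ~-trans z~x x~y) (λ z~y → ~-trans z~y (~-sym x~y))
        found : ∀ r → r ≢ nothing → fromMaybe x r ≡ fromMaybe y r
        found (just _) _       = refl
        found nothing  r≢nothing = ⊥-elim (r≢nothing refl)

  canon-injective : ∀ {x y} → canon x ≡ canon y → x ~ y
  canon-injective {x} {y} eq = ~-trans (~-sym (canon-~ x)) (subst (_~ y) (sym eq) (canon-~ y))

  canon-idempotent : ∀ x → canon (canon x) ≡ canon x
  canon-idempotent x = canon-cong (canon-~ x)

module Walks (D : Digraph) where

  _∷ʳ_ : ∀ {i u x y} → Walk D i u x → Edge D x y → Walk D (suc i) u y
  nil      ∷ʳ e = cons e nil
  cons f w ∷ʳ e = cons f (w ∷ʳ e)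

  _++_ : ∀ {i j u x v} → Walk D i u x → Walk D j x v → Walk D (i + j) u v
  nil      ++ w = w
  cons e r ++ w = cons e (r ++ w)

  splitWalk : ∀ i {j u v} → Walk D (i + j) u v → ∃ λ x → Walk D i u x × Walk D j x v
  splitWalk zero    w          = _ , nil , w
  splitWalk (suc i) (cons e w) with splitWalk i w
  ... | x , w₁ , w₂ = x , cons e w₁ , w₂

  cons-injective : ∀ {i u c c′ v} {e : Edge D u c} {e′ : Edge D u c′} {w : Walk D i c v} {w′ : Walk D i c′ v} →
                   cons e w ≡ cons e′ w′ → Σ (c ≡ c′) λ { refl → w ≡ w′ }
  cons-injective refl = refl , refl

  ++-middle-unique : ∀ {i j u v x x′} (w₁ : Walk D i u x) (w₂ : Walk D j x v) (w₁′ : Walk D i u x′) (w₂′ : Walk D j x′ v) →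
                     w₁ ++ w₂ ≡ w₁′ ++ w₂′ → x ≡ x′
  ++-middle-unique nil        _  nil          _   _ = refl
  ++-middle-unique (cons _ w₁) w₂ (cons _ w₁′) w₂′ p with cons-injective p
  ... | refl , q = ++-middle-unique w₁ w₂ w₁′ w₂′ q

  walkFrom : NoSinks D → ∀ i u → ∃ λ v → Walk D i u v
  walkFrom noSinks zero    u = u , nil
  walkFrom noSinks (suc i) u with noSinks u
  ... | x , e with walkFrom noSinks i x
  ... | v , w = v , cons e w

  walk? : ∀ i a b → Dec (Walk D i a b)
  walk? zero a b with a ≟ᶠ b
  ... | yes refl = yes nil
  ... | no  a≢b  = no λ { nil → a≢b refl }
  walk? (suc i) a b = map′ (λ { (_ , e , w) → cons e w }) (λ { (cons e w) → _ , e , w })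
                        (any? λ x → T? (Digraph.adj D a x) ×-dec walk? i x b)

  Meet : ℕ → Vertex D → Vertex D → Set
  Meet i a b = ∃ λ x → Walk D i a x × Walk D i b x

  -- When D has no sinks, the classes of Linked i are exactly the i-th order coresets.
  Linked : ℕ → Vertex D → Vertex D → Set
  Linked i = Star (Meet i)

  Linked-sym : ∀ {i a b} → Linked i a b → Linked i b a
  Linked-sym = reverse λ { (x , w , w′) → x , w′ , w }

  meet? : ∀ i a b → Dec (Meet i a b)
  meet? i a b = any? λ x → walk? i a x ×-dec walk? i b x

  Linked-zero : ∀ {a b} → Linked 0 a b → a ≡ b
  Linked-zero ε                     = refl
  Linked-zero ((_ , nil , nil) ◅ a~b) = Linked-zero a~b

  Linked-suc : NoSinks D → ∀ {i a b} → Linked i a b → Linked (suc i) a b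
  Linked-suc noSinks = gmap id λ { (x , w , w′) → let (y , e) = noSinks x in y , w ∷ʳ e , w′ ∷ʳ e }

  Linked-+ : NoSinks D → ∀ d {i a b} → Linked i a b → Linked (d + i) a b
  Linked-+ noSinks zero    a~b = a~b
  Linked-+ noSinks (suc d) a~b = Linked-suc noSinks (Linked-+ noSinks d a~b)

  Linked-mono : NoSinks D → ∀ {i j a b} → i ≤ j → Linked i a b → Linked j a b
  Linked-mono noSinks {i} {j} i≤j a~b with j ∸ i | m+[n∸m]≡n i≤j
  ... | d | refl rewrite +-comm i d = Linked-+ noSinks d a~b

  Linked-closed : ∀ {i} {U : Pred (Vertex D) 0ℓ} → Closed D i U → ∀ {a b} → U a → Linked i a b → U b
  Linked-closed cl ua ε                    = ua
  Linked-closed cl ua ((x , w , w′) ◅ a~b) = Linked-closed cl (proj₁ cl (x , (_ , ua , w) , w′)) a~b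

  Linked-isCoreset : NoSinks D → ∀ i u → IsCoreset D i (Linked i u)
  Linked-isCoreset noSinks i u = (u , ε) , (βα⊆ , ⊆βα) , minimal
    where
      βα⊆ : β D i (α D i (Linked i u)) ⊆ Linked i u
      βα⊆ (x , (y , u~y , w) , w′) = u~y ◅◅ return (x , w , w′)
      ⊆βα : Linked i u ⊆ β D i (α D i (Linked i u))
      ⊆βα {v} u~v with walkFrom noSinks i v
      ... | x , w = x , (v , u~v , w) , w
      minimal : ∀ U → Satisfiable U → U ⊆ Linked i u → Closed D i U → Linked i u ⊆ U
      minimal U (w , Uw) U⊆ cl u~v = Linked-closed cl (Linked-closed cl Uw (Linked-sym (U⊆ Uw))) u~v

  coreset⇒Linked : NoSinks D → ∀ i U → IsCoreset D i U → ∀ {u u′} → U u → U u′ → Linked i u u′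
  coreset⇒Linked noSinks i U (_ , cl , minimal) Uu =
    minimal (Linked i _) (_ , ε) (Linked-closed cl Uu) (proj₁ (proj₂ (Linked-isCoreset noSinks i _)))

  CoresetWalksUnique : ℕ → Set₁
  CoresetWalksUnique n = ∀ (i : ℕ) → 1 ≤ i → i ≤ n → (U : Pred (Vertex D) 0ℓ) → IsCoreset D i U →
                         ∀ u v → U u → α D i U v → UniqueWalk D i u v

  LinkedWalksUnique : ℕ → Set
  LinkedWalksUnique n = ∀ i → 1 ≤ i → i ≤ n → ∀ {u u′ v} → Linked i u u′ → Walk D i u′ v → UniqueWalk D i u v

  LinkedWalksUnique⇒CoresetWalksUnique : NoSinks D → ∀ n → LinkedWalksUnique n → CoresetWalksUnique n
  LinkedWalksUnique⇒CoresetWalksUnique noSinks n unique i 1≤i i≤n U coreset u v Uu (u′ , Uu′ , w) =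
    unique i 1≤i i≤n (coreset⇒Linked noSinks i U coreset Uu Uu′) w

  CoresetWalksUnique⇒LinkedWalksUnique : NoSinks D → ∀ n → CoresetWalksUnique n → LinkedWalksUnique n
  CoresetWalksUnique⇒LinkedWalksUnique noSinks n unique i 1≤i i≤n {u} {u′} {v} u~u′ w =
    unique i 1≤i i≤n (Linked i u) (Linked-isCoreset noSinks i u) u v ε (u′ , u~u′ , w)

module EdgeSequence (G : MDigraph) where
  open MDigraph G

  Edgeᴸ : ℕ → Set
  Edgeᴸ k = MDigraph.E (L^ k G)

  headᴸ tailᴸ : ∀ k → Edgeᴸ k → MDigraph.V (L^ k G)
  headᴸ k = MDigraph.head (L^ k G)
  tailᴸ k = MDigraph.tail (L^ k G)

  -- An edge of L^k G is a walk of k + 1 edges of G; edges k a j is its j-th edge.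
  -- Sequences ℕ → E are only ever compared at indices j ≤ k.
  edges : (k : ℕ) → Edgeᴸ k → ℕ → E
  edges zero    a              j       = a
  edges (suc k) ((a , _) , _) zero    = edges k a zero
  edges (suc k) ((_ , b) , _) (suc j) = edges k b j

  IsEdgeWalk : ℕ → (ℕ → E) → Set
  IsEdgeWalk k e = ∀ j → j < k → head (e j) ≡ tail (e (suc j))

  vertices : (ℕ → E) → ℕ → V
  vertices e zero    = tail (e zero)
  vertices e (suc j) = head (e j)

  AgreeUpTo : ℕ → (ℕ → E) → (ℕ → E) → Set
  AgreeUpTo k e f = ∀ j → j ≤ k → e j ≡ f j

  Overlap : ℕ → ℕ → (ℕ → E) → (ℕ → E) → Set
  Overlap k i e f = (∀ j → i + j ≤ k → e (i + j) ≡ f j)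
                  × (∀ j → i + j ≤ suc k → vertices e (i + j) ≡ vertices f j)

  vertices-tail : ∀ {k e} → IsEdgeWalk k e → ∀ j → j ≤ k → vertices e j ≡ tail (e j)
  vertices-tail w zero    _  = refl
  vertices-tail w (suc j) le = w j le

  edges-prefix : ∀ k {a b : Edgeᴸ k} (p : headᴸ k a ≡ tailᴸ k b) →
                 ∀ j → j ≤ k → edges (suc k) ((a , b) , p) j ≡ edges k a j
  edges-shift : ∀ k {a b : Edgeᴸ k} → headᴸ k a ≡ tailᴸ k b →
                ∀ j → suc j ≤ k → edges k a (suc j) ≡ edges k b j

  edges-prefix k p zero    _  = refl
  edges-prefix k p (suc j) le = sym (edges-shift k p j le)

  edges-shift (suc k) {(_ , a₂) , _} {(b₁ , _) , q} a₂≡b₁ j (s≤s le) =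
    trans (cong (λ c → edges k c j) a₂≡b₁) (sym (edges-prefix k q j le))

  edges-walk : ∀ k (a : Edgeᴸ k) → IsEdgeWalk k (edges k a)
  edges-walk (suc zero)    (_ , p)             zero    _        = p
  edges-walk (suc (suc k)) ((a₁ , _) , a₂≡b₁) zero    _        =
    trans (edges-walk (suc k) a₁ zero (s≤s z≤n)) (cong (λ c → tail (edges k c zero)) a₂≡b₁)
  edges-walk (suc k)       ((_ , b) , _)       (suc j) (s≤s le) = edges-walk k b j le

  edges-injective : ∀ k {a b : Edgeᴸ k} → AgreeUpTo k (edges k a) (edges k b) → a ≡ b
  edges-injective zero    ag = ag zero z≤n
  edges-injective (suc k) {(a₁ , a₂) , p} {(b₁ , b₂) , q} ag
    with edges-injective k {a₁} {b₁} (λ j le → trans (sym (edges-prefix k p j le))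
                                  (trans (ag j (≤-trans le (n≤1+n k))) (edges-prefix k q j le)))
       | edges-injective k {a₂} {b₂} (λ j le → ag (suc j) (s≤s le))
  ... | refl | refl = cong (λ r → ((a₁ , a₂) , r)) (uip p q)

  edges-surjective : ∀ k e → IsEdgeWalk k e → ∃ λ a → AgreeUpTo k (edges k a) e
  edges-surjective zero    e _ = e zero , λ { zero z≤n → refl }
  edges-surjective (suc k) e w
    with edges-surjective k e (λ j le → w j (≤-trans le (n≤1+n k)))
       | edges-surjective k (λ j → e (suc j)) (λ j le → w (suc j) (s≤s le))
  ... | a , a≈e | b , b≈e₊ = ((a , b) , link k a≈e b≈e₊) , agree
    where
      link : ∀ k {a b : Edgeᴸ k} → AgreeUpTo k (edges k a) e → AgreeUpTo k (edges k b) (λ j → e (suc j)) →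
             headᴸ k a ≡ tailᴸ k b
      link zero    a≈e b≈e₊ = trans (cong head (a≈e zero z≤n))
                                (trans (w zero (s≤s z≤n)) (cong tail (sym (b≈e₊ zero z≤n))))
      link (suc k) {a} {(_ , _) , q} a≈e b≈e₊ = edges-injective k λ j le →
        trans (a≈e (suc j) (s≤s le)) (trans (sym (b≈e₊ j (≤-trans le (n≤1+n k)))) (edges-prefix k q j le))
      agree : AgreeUpTo (suc k) (edges (suc k) ((a , b) , link k a≈e b≈e₊)) e
      agree zero    _        = a≈e zero z≤n
      agree (suc j) (s≤s le) = b≈e₊ j le

  link⇒overlap : ∀ k {a b : Edgeᴸ k} → headᴸ k a ≡ tailᴸ k b → Overlap k 1 (edges k a) (edges k b)
  link⇒overlap zero    p = (λ _ ()) , λ { zero _ → p ; (suc j) (s≤s ()) }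
  link⇒overlap (suc k) {a} {b} p = edges-shift (suc k) {a} {b} p , vertex
    where
      vertex : ∀ j → suc j ≤ suc (suc k) → vertices (edges (suc k) a) (suc j) ≡ vertices (edges (suc k) b) j
      vertex zero    _        = trans (edges-walk (suc k) a zero (s≤s z≤n))
                                  (cong tail (edges-shift (suc k) {a} {b} p zero (s≤s z≤n)))
      vertex (suc j) (s≤s le) = cong head (edges-shift (suc k) {a} {b} p j le)

  overlap⇒link : ∀ k {a b : Edgeᴸ k} → Overlap k 1 (edges k a) (edges k b) → headᴸ k a ≡ tailᴸ k b
  overlap⇒link zero                       (_ , vertex) = vertex zero (s≤s z≤n)
  overlap⇒link (suc k) {(_ , _) , _} {b} (edge , _)   =
    edges-injective k λ j le → trans (edge j (s≤s le)) (edges-prefix k (proj₂ b) j le)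

  overlap-resp : ∀ {k e e′ f f′} → AgreeUpTo k e e′ → AgreeUpTo k f f′ → Overlap k 1 e f → Overlap k 1 e′ f′
  overlap-resp {k} {e} {e′} {f} {f′} e≈e′ f≈f′ (edge , vertex) =
      (λ j le → trans (sym (e≈e′ (suc j) le)) (trans (edge j le) (f≈f′ j (≤-trans (n≤1+n j) le))))
    , vertex′
    where
      vertex′ : ∀ j → suc j ≤ suc k → vertices e′ (suc j) ≡ vertices f′ j
      vertex′ zero    le       = subst₂ (λ x y → head x ≡ tail y) (e≈e′ zero z≤n) (f≈f′ zero z≤n) (vertex zero le)
      vertex′ (suc j) (s≤s le) =
        subst₂ (λ x y → head x ≡ head y) (e≈e′ (suc j) le) (f≈f′ j (≤-trans (n≤1+n j) le)) (vertex (suc j) (s≤s le))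

  SameFrom : ℕ → ℕ → (ℕ → E) → (ℕ → E) → Set
  SameFrom k i e f = (∀ j → i ≤ j → j ≤ k → e j ≡ f j)
                   × (∀ j → i ≤ j → j ≤ suc k → vertices e j ≡ vertices f j)

  SameFrom-refl : ∀ {k i e} → SameFrom k i e e
  SameFrom-refl = (λ _ _ _ → refl) , (λ _ _ _ → refl)

  SameFrom-trans : ∀ {k i e f g} → SameFrom k i e f → SameFrom k i f g → SameFrom k i e g
  SameFrom-trans (e=f , e=fᵛ) (f=g , f=gᵛ) =
    (λ j i≤j j≤k → trans (e=f j i≤j j≤k) (f=g j i≤j j≤k)) , (λ j i≤j j≤k → trans (e=fᵛ j i≤j j≤k) (f=gᵛ j i≤j j≤k))

  overlaps⇒SameFrom : ∀ {k i e f g} → Overlap k i e g → Overlap k i f g → SameFrom k i e f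
  overlaps⇒SameFrom {k} {i} {e} {f} (eg , egᵛ) (fg , fgᵛ) = edge , vertex
    where
      edge : ∀ j → i ≤ j → j ≤ k → e j ≡ f j
      edge j i≤j j≤k with j ∸ i | m+[n∸m]≡n i≤j
      ... | d | refl = trans (eg d j≤k) (sym (fg d j≤k))
      vertex : ∀ j → i ≤ j → j ≤ suc k → vertices e j ≡ vertices f j
      vertex j i≤j j≤k with j ∸ i | m+[n∸m]≡n i≤j
      ... | d | refl = trans (egᵛ d j≤k) (sym (fgᵛ d j≤k))

  shiftIn : ℕ → (ℕ → E) → (ℕ → E) → ℕ → E
  shiftIn k e f j with suc j ≤? k
  ... | yes _ = e (suc j)
  ... | no  _ = f j

  shiftIn-< : ∀ k e f {j} → suc j ≤ k → shiftIn k e f j ≡ e (suc j)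
  shiftIn-< k e f {j} j<k with suc j ≤? k
  ... | yes _  = refl
  ... | no j≮k = ⊥-elim (j≮k j<k)

  shiftIn-last : ∀ k e f → shiftIn k e f k ≡ f k
  shiftIn-last k e f with suc k ≤? k
  ... | yes k<k = ⊥-elim (1+n≰n k<k)
  ... | no  _   = refl

  module _ {k : ℕ} {e f : ℕ → E} (walk : IsEdgeWalk k e) (joins : head (e k) ≡ tail (f k)) where

    shiftIn-joins : ∀ j → j ≤ k → head (e j) ≡ tail (shiftIn k e f j)
    shiftIn-joins j j≤k with m≤n⇒m<n∨m≡n j≤k
    ... | inj₁ j<k  = trans (walk j j<k) (cong tail (sym (shiftIn-< k e f j<k)))
    ... | inj₂ refl = trans joins (cong tail (sym (shiftIn-last k e f)))

    shiftIn-walk : IsEdgeWalk k (shiftIn k e f)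
    shiftIn-walk j j<k = trans (cong head (shiftIn-< k e f j<k)) (shiftIn-joins (suc j) j<k)

    shiftIn-overlap : ∀ {g} → IsEdgeWalk k g → AgreeUpTo k g (shiftIn k e f) → Overlap k 1 e g
    shiftIn-overlap {g} walkᵍ g≈ =
        (λ j j<k → trans (sym (shiftIn-< k e f j<k)) (sym (g≈ j (<⇒≤ j<k))))
      , λ j j≤k → trans (shiftIn-joins j (≤-pred j≤k))
                   (trans (cong tail (sym (g≈ j (≤-pred j≤k)))) (sym (vertices-tail walkᵍ j (≤-pred j≤k))))

module _ (G : MDigraph) where
  open EdgeSequence G

  -- D ≅ L^(k+1) G, seen on D: vertices are walks of k + 1 edges, and u → v iff code v is code u shifted by one.
  record SequenceModel (D : Digraph) (k : ℕ) : Set where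
    field
      code            : Vertex D → ℕ → MDigraph.E G
      code-walk       : ∀ u → IsEdgeWalk k (code u)
      code-injective  : ∀ u v → AgreeUpTo k (code u) (code v) → u ≡ v
      code-surjective : ∀ e → IsEdgeWalk k e → ∃ λ u → AgreeUpTo k (code u) e
      edge⇔overlap    : ∀ u v → Edge D u v ⇔ Overlap k 1 (code u) (code v)

  module _ {D : Digraph} {k : ℕ} where

    ≅⇒SequenceModel : D ≅ L^ (suc k) G → SequenceModel D k
    ≅⇒SequenceModel (φ , edge⇔) = record
      { code            = λ u → edges k (to u)
      ; code-walk       = λ u → edges-walk k (to u)
      ; code-injective  = λ u v ag → injective (edges-injective k ag)
      ; code-surjective = surjective′
      ; edge⇔overlap    = λ u v → mk⇔ (edge⇒overlap u v) (overlap⇒edge u v)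
      }
      where
        open Bijection φ using (to; injective; surjective)
        surjective′ : ∀ e → IsEdgeWalk k e → ∃ λ u → AgreeUpTo k (edges k (to u)) e
        surjective′ e w with edges-surjective k e w
        ... | a , a≈e with surjective a
        ... | u , to⁻ = u , λ j le → trans (cong (λ c → edges k c j) (to⁻ refl)) (a≈e j le)
        edge⇒overlap : ∀ u v → Edge D u v → Overlap k 1 (edges k (to u)) (edges k (to v))
        edge⇒overlap u v uv with Equivalence.to (edge⇔ u v) uv
        ... | ((a , b) , p) , refl , refl = link⇒overlap k p
        overlap⇒edge : ∀ u v → Overlap k 1 (edges k (to u)) (edges k (to v)) → Edge D u v
        overlap⇒edge u v o = Equivalence.from (edge⇔ u v) (((to u , to v) , overlap⇒link k o) , refl , refl)

    SequenceModel⇒≅ : SequenceModel D k → D ≅ L^ (suc k) G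
    SequenceModel⇒≅ M = mk⤖ {to = to} (injective , surjective) , λ u v → mk⇔ (edge⇒link u v) (link⇒edge u v)
      where
        open SequenceModel M
        to : Vertex D → Edgeᴸ k
        to u = proj₁ (edges-surjective k (code u) (code-walk u))
        to≈code : ∀ u → AgreeUpTo k (edges k (to u)) (code u)
        to≈code u = proj₂ (edges-surjective k (code u) (code-walk u))
        injective : ∀ {u v} → to u ≡ to v → u ≡ v
        injective {u} {v} p = code-injective u v λ j le →
          trans (sym (to≈code u j le)) (trans (cong (λ c → edges k c j) p) (to≈code v j le))
        surjective : ∀ a → ∃ λ u → ∀ {z} → z ≡ u → to z ≡ a
        surjective a with code-surjective (edges k a) (edges-walk k a)
        ... | u , u≈a = u , λ { refl → edges-injective k λ j le → trans (to≈code u j le) (u≈a j le) }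
        edge⇒link : ∀ u v → Edge D u v → ∃ λ (e : Edgeᴸ (suc k)) → (tailᴸ (suc k) e ≡ to u) × (headᴸ (suc k) e ≡ to v)
        edge⇒link u v uv = ((to u , to v) , overlap⇒link k o) , refl , refl
          where
            o : Overlap k 1 (edges k (to u)) (edges k (to v))
            o = overlap-resp (λ j le → sym (to≈code u j le)) (λ j le → sym (to≈code v j le))
                  (Equivalence.to (edge⇔overlap u v) uv)
        link⇒edge : ∀ u v → (∃ λ (e : Edgeᴸ (suc k)) → (tailᴸ (suc k) e ≡ to u) × (headᴸ (suc k) e ≡ to v)) → Edge D u v
        link⇒edge u v (((a , b) , p) , refl , refl) =
          Equivalence.from (edge⇔overlap u v) (overlap-resp (to≈code u) (to≈code v) (link⇒overlap k p))

module FromSequenceModel {G : MDigraph} {D : Digraph} {k : ℕ} (M : SequenceModel G D k) where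
  open MDigraph G
  open EdgeSequence G
  open SequenceModel M
  open Walks D

  edge⇒overlap : ∀ {u v} → Edge D u v → Overlap k 1 (code u) (code v)
  edge⇒overlap {u} {v} = Equivalence.to (edge⇔overlap u v)

  overlap⇒edge : ∀ {u v} → Overlap k 1 (code u) (code v) → Edge D u v
  overlap⇒edge {u} {v} = Equivalence.from (edge⇔overlap u v)

  walk⇒overlap : ∀ {i u v} → Walk D i u v → Overlap k i (code u) (code v)
  walk⇒overlap nil = (λ _ _ → refl) , (λ _ _ → refl)
  walk⇒overlap {suc i} (cons e w) with edge⇒overlap e | walk⇒overlap w
  ... | (e₁ , eᵛ) | (w₁ , wᵛ) =
      (λ j le → trans (e₁ (i + j) le) (w₁ j (≤-trans (n≤1+n _) le)))
    , (λ j le → trans (eᵛ (i + j) le) (wᵛ j (≤-trans (n≤1+n _) le)))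

  Linked⇒SameFrom : ∀ {i u u′} → Linked i u u′ → SameFrom k i (code u) (code u′)
  Linked⇒SameFrom ε                    = SameFrom-refl
  Linked⇒SameFrom ((x , w , w′) ◅ u~u′) =
    SameFrom-trans (overlaps⇒SameFrom (walk⇒overlap w) (walk⇒overlap w′)) (Linked⇒SameFrom u~u′)

  -- The vertex y is the one coded by code u shifted by one and completed with the last edge of code y′.
  lift-edge : ∀ {i u u′ y′} → i ≤ k → SameFrom k (suc i) (code u) (code u′) → Edge D u′ y′ →
              ∃ λ y → Edge D u y × SameFrom k i (code y) (code y′)
  lift-edge {i} {u} {u′} {y′} i≤k (u=u′ , u=u′ᵛ) u′y′ = y , overlap⇒edge uy , y=y′ , y=y′ᵛ
    where
      o : Overlap k 1 (code u′) (code y′)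
      o = edge⇒overlap u′y′
      joins : head (code u k) ≡ tail (code y′ k)
      joins = trans (u=u′ᵛ (suc k) (s≤s i≤k) ≤-refl)
                (trans (proj₂ o k ≤-refl) (vertices-tail (code-walk y′) k ≤-refl))
      y : Vertex D
      y = proj₁ (code-surjective _ (shiftIn-walk (code-walk u) joins))
      y≈ : AgreeUpTo k (code y) (shiftIn k (code u) (code y′))
      y≈ = proj₂ (code-surjective _ (shiftIn-walk (code-walk u) joins))
      uy : Overlap k 1 (code u) (code y)
      uy = shiftIn-overlap (code-walk u) joins (code-walk y) y≈
      y=y′ : ∀ j → i ≤ j → j ≤ k → code y j ≡ code y′ j
      y=y′ j i≤j j≤k with m≤n⇒m<n∨m≡n j≤k
      ... | inj₁ j<k  = trans (sym (proj₁ uy j j<k)) (trans (u=u′ (suc j) (s≤s i≤j) j<k) (proj₁ o j j<k))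
      ... | inj₂ refl = trans (y≈ k ≤-refl) (shiftIn-last k (code u) (code y′))
      y=y′ᵛ : ∀ j → i ≤ j → j ≤ suc k → vertices (code y) j ≡ vertices (code y′) j
      y=y′ᵛ j i≤j j≤k+1 with m≤n⇒m<n∨m≡n j≤k+1
      ... | inj₁ (s≤s j≤k) = trans (sym (proj₂ uy j (s≤s j≤k)))
                               (trans (u=u′ᵛ (suc j) (s≤s i≤j) (s≤s j≤k)) (proj₂ o j (s≤s j≤k)))
      ... | inj₂ refl = cong head (y=y′ k i≤k ≤-refl)

  transport-walk : ∀ i {u u′ v} → i ≤ suc k → SameFrom k i (code u) (code u′) → Walk D i u′ v → Walk D i u v
  transport-walk zero {u} {u′} _ (u=u′ , _) nil with code-injective u u′ (λ j → u=u′ j z≤n)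
  ... | refl = nil
  transport-walk (suc i) (s≤s i≤k) same (cons e w) with lift-edge i≤k same e
  ... | y , e′ , same′ = cons e′ (transport-walk i (≤-trans i≤k (n≤1+n k)) same′ w)

  walk-unique : ∀ i {u v} (w w′ : Walk D i u v) → i ≤ suc k → w ≡ w′
  walk-unique zero nil nil _ = refl
  walk-unique (suc i) (cons {w = a} e w) (cons {w = b} e′ w′) (s≤s i≤k)
    with code-injective a b a≈b
    where
      a≈b : AgreeUpTo k (code a) (code b)
      a≈b j j≤k with m≤n⇒m<n∨m≡n j≤k
      ... | inj₁ j<k  = trans (sym (proj₁ (edge⇒overlap e) j j<k)) (proj₁ (edge⇒overlap e′) j j<k)
      ... | inj₂ refl = proj₁ (Linked⇒SameFrom (return (_ , w , w′))) k i≤k ≤-refl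
  ... | refl with T-irrelevant e e′ | walk-unique i w w′ (≤-trans i≤k (n≤1+n k))
  ...   | refl | refl = refl

  SequenceModel⇒LinkedWalksUnique : LinkedWalksUnique (suc k)
  SequenceModel⇒LinkedWalksUnique i _ i≤n u~u′ w =
    transport-walk i i≤n (Linked⇒SameFrom u~u′) w , λ w′ → walk-unique i w′ _ i≤n

module Construction (D : Digraph) (noSources : NoSources D) (noSinks : NoSinks D) (k : ℕ)
                    (unique : Walks.LinkedWalksUnique D (suc k)) where
  open Digraph D using () renaming (size to m)
  open Walks D

  walks-unique : ∀ {i a b} → 1 ≤ i → i ≤ suc k → (w w′ : Walk D i a b) → w ≡ w′
  walks-unique 1≤i i≤n w w′ with unique _ 1≤i i≤n ε w
  ... | _ , all≡ = trans (all≡ w) (sym (all≡ w′))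

  transport : ∀ {i a b v} → i ≤ suc k → Linked i a b → Walk D i b v → Walk D i a v
  transport {zero}  _   a~b w with Linked-zero a~b
  ... | refl = w
  transport {suc i} i≤n a~b w = proj₁ (unique (suc i) (s≤s z≤n) i≤n a~b w)

  Linked⇒Meet : ∀ {i a b} → i ≤ suc k → Linked i a b → Meet i a b
  Linked⇒Meet {i} {b = b} i≤n a~b with walkFrom noSinks i b
  ... | x , w = x , transport i≤n a~b w , w

  Linked-isDecEquivalence : ∀ {i} → i ≤ suc k → IsDecEquivalence (Linked i)
  Linked-isDecEquivalence {i} i≤n = record
    { isEquivalence = record { refl = ε ; sym = Linked-sym ; trans = _◅◅_ }
    ; _≟_           = λ a b → map′ return (Linked⇒Meet i≤n) (meet? i a b)
    }

  open Canonical (Linked-isDecEquivalence (n≤1+n k)) using () renaming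
    (canon to repₖ; canon-~ to repₖ-~; canon-cong to repₖ-cong; canon-injective to repₖ-injective;
     canon-idempotent to repₖ-idempotent)
  open Canonical (Linked-isDecEquivalence ≤-refl) using () renaming
    (canon to repₙ; canon-cong to repₙ-cong; canon-injective to repₙ-injective)

  pred : Vertex D → Vertex D
  pred v = proj₁ (noSources v)

  pred-edge : ∀ v → Edge D (pred v) v
  pred-edge v = proj₂ (noSources v)

  pred^ : ℕ → Vertex D → Vertex D
  pred^ zero    v = v
  pred^ (suc d) v = pred (pred^ d v)

  pred^-walk : ∀ d v → Walk D d (pred^ d v) v
  pred^-walk zero    v = nil
  pred^-walk (suc d) v = cons (pred-edge (pred^ d v)) (pred^-walk d v)

  walk⇒repₖ : ∀ d {w u} → d ≤ k → Walk D d w u → repₖ w ≡ repₖ (pred^ d u)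
  walk⇒repₖ d d≤k w = repₖ-cong (Linked-mono noSinks d≤k (return (_ , w , pred^-walk d _)))

  extend : ∀ {w f} → Linked (suc k) w (pred f) → ∃ λ y → Edge D w y × Linked k y f
  extend {w} {f} w~ with walkFrom noSinks k f
  ... | x , fx with transport ≤-refl w~ (cons (pred-edge f) fx)
  ... | cons {w = y} e yx = y , e , return (x , yx , fx)

  -- Both routes pred^(d+1) v → v → z and pred^(d+1) v → y → x → z have length d + j + 2 ≤ k + 1,
  -- so they coincide and y = v.
  Linked-descend : ∀ {u v} j d → suc d + suc j ≤ suc k → Linked (suc j) u v →
                   Linked (suc d + j) (pred^ (suc d) u) (pred^ (suc d) v) → Linked j u v
  Linked-descend {u} {v} j d bound u~v pu~pv with walkFrom noSinks j u
  ... | x , ux with noSinks x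
  ... | z , xz with splitWalk (suc d) (transport (≤-trans (+-monoʳ-≤ (suc d) (n≤1+n j)) bound)
                                         (Linked-sym pu~pv) (pred^-walk (suc d) u ++ ux))
  ... | y , py , yx = return (x , ux , subst (λ c → Walk D j c x) (sym v≡y) yx)
    where
      vz : Walk D (suc j) v z
      vz = transport (≤-trans (m≤n+m (suc j) (suc d)) bound) (Linked-sym u~v) (ux ∷ʳ xz)
      v≡y : v ≡ y
      v≡y = ++-middle-unique (pred^-walk (suc d) v) vz py (yx ∷ʳ xz)
              (walks-unique (s≤s z≤n) bound (pred^-walk (suc d) v ++ vz) (py ++ (yx ∷ʳ xz)))

  IsRep : Vertex D → Set
  IsRep e = repₖ e ≡ e

  Node : Set
  Node = Fin m ⊎ (Fin m ⊎ Fin m)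

  -- A vertex that is not a representative becomes an isolated edge between two private nodes.
  tailNode headNode : Vertex D → Node
  tailNode e with repₖ e ≟ᶠ e
  ... | yes _ = inj₁ (repₙ (pred e))
  ... | no  _ = inj₂ (inj₁ e)
  headNode e with repₖ e ≟ᶠ e
  ... | yes _ = inj₁ (repₙ e)
  ... | no  _ = inj₂ (inj₂ e)

  tailNode-rep : ∀ {e} → IsRep e → tailNode e ≡ inj₁ (repₙ (pred e))
  tailNode-rep {e} rep with repₖ e ≟ᶠ e
  ... | yes _    = refl
  ... | no  ¬rep = ⊥-elim (¬rep rep)

  headNode-rep : ∀ {e} → IsRep e → headNode e ≡ inj₁ (repₙ e)
  headNode-rep {e} rep with repₖ e ≟ᶠ e
  ... | yes _    = refl
  ... | no  ¬rep = ⊥-elim (¬rep rep)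

  joins⇒IsRep : ∀ {a b} → headNode a ≡ tailNode b → IsRep a × IsRep b
  joins⇒IsRep {a} {b} eq with repₖ a ≟ᶠ a | repₖ b ≟ᶠ b
  joins⇒IsRep _  | yes ra | yes rb = ra , rb
  joins⇒IsRep () | yes _  | no _
  joins⇒IsRep () | no _   | yes _
  joins⇒IsRep () | no _   | no _

  Linked⇒joins : ∀ {a b} → IsRep a → IsRep b → Linked (suc k) a (pred b) → headNode a ≡ tailNode b
  Linked⇒joins ra rb a~pb = trans (headNode-rep ra) (trans (cong inj₁ (repₙ-cong a~pb)) (sym (tailNode-rep rb)))

  joins⇒Linked : ∀ {a b} → headNode a ≡ tailNode b → Linked (suc k) a (pred b)
  joins⇒Linked eq with joins⇒IsRep eq
  ... | ra , rb = repₙ-injective (inj₁-injective (trans (sym (headNode-rep ra)) (trans eq (tailNode-rep rb))))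

  node : Node → Fin (m + (m + m))
  node = join m (m + m) ∘ map₂ (join m m)

  node-injective : ∀ {x y} → node x ≡ node y → x ≡ y
  node-injective {x} {y} eq = trans (sym (unnode-node x)) (trans (cong unnode eq) (unnode-node y))
    where
      unnode : Fin (m + (m + m)) → Node
      unnode = map₂ (splitAt m) ∘ splitAt m
      unnode-node : ∀ x → unnode (node x) ≡ x
      unnode-node (inj₁ x) = cong (map₂ (splitAt m)) (splitAt-join m (m + m) (inj₁ x))
      unnode-node (inj₂ x) = trans (cong (map₂ (splitAt m)) (splitAt-join m (m + m) (inj₂ (join m m x))))
                                   (cong inj₂ (splitAt-join m m x))

  G : MDigraph
  G = finMDigraph (m + (m + m)) m (node ∘ tailNode) (node ∘ headNode)

  open EdgeSequence G

  code : Vertex D → ℕ → Vertex D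
  code u j = repₖ (pred^ (k ∸ j) u)

  code-at : ∀ {u} j d → j + d ≡ k → code u j ≡ repₖ (pred^ d u)
  code-at {u} j d eq = cong (λ i → repₖ (pred^ i u)) (trans (cong (_∸ j) (sym eq)) (m+n∸m≡n j d))

  code-last : ∀ u → code u k ≡ repₖ u
  code-last u = cong (λ i → repₖ (pred^ i u)) (n∸n≡0 k)

  edge⇒joins : ∀ {u v} → Edge D u v → headNode (repₖ u) ≡ tailNode (repₖ v)
  edge⇒joins {u} {v} uv with walkFrom noSinks k v
  ... | x , vx = Linked⇒joins (repₖ-idempotent u) (repₖ-idempotent v)
    (Linked-suc noSinks (repₖ-~ u) ◅◅ return (x , cons uv vx , cons (pred-edge (repₖ v)) (transport (n≤1+n k) (repₖ-~ v) vx)))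

  code-walk : ∀ u → IsEdgeWalk k (code u)
  code-walk u j j<k = cong node
    (subst₂ (λ a b → headNode a ≡ tailNode b) (sym (code-at j (suc d) (trans (+-suc j d) eq))) (sym (code-at (suc j) d eq))
      (edge⇒joins (pred-edge (pred^ d u))))
    where
      d : ℕ
      d = k ∸ suc j
      eq : suc j + d ≡ k
      eq = m+[n∸m]≡n j<k

  code-shift : ∀ {u v} → Edge D u v → ∀ j → suc j ≤ k → code u (suc j) ≡ code v j
  code-shift {u} {v} uv j j<k =
    trans (code-at (suc j) d eq) (trans (walk⇒repₖ (suc d) (≤-trans (s≤s (m≤n+m d j)) (≤-reflexive eq)) (pred^-walk d u ∷ʳ uv))
                              (sym (code-at j (suc d) (trans (+-suc j d) eq))))
    where
      d : ℕ
      d = k ∸ suc j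
      eq : suc j + d ≡ k
      eq = m+[n∸m]≡n j<k

  code-joins : ∀ {u v} → Edge D u v → ∀ j → j ≤ k → headNode (code u j) ≡ tailNode (code v j)
  code-joins {u} {v} uv j j≤k with m≤n⇒m<n∨m≡n j≤k
  ... | inj₁ j<k  = trans (node-injective (code-walk u j j<k)) (cong tailNode (code-shift uv j j<k))
  ... | inj₂ refl = subst₂ (λ a b → headNode a ≡ tailNode b) (sym (code-last u)) (sym (code-last v)) (edge⇒joins uv)

  edge⇒overlap : ∀ {u v} → Edge D u v → Overlap k 1 (code u) (code v)
  edge⇒overlap {u} {v} uv = code-shift uv , λ j j<k+1 →
    trans (cong node (code-joins uv j (≤-pred j<k+1))) (sym (vertices-tail (code-walk v) j (≤-pred j<k+1)))

  code-agree⇒Linked : ∀ {u v} → AgreeUpTo k (code u) (code v) → ∀ j d → j + d ≡ k → Linked j u v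
  code-agree⇒Linked {u} {v} agree j zero eq with trans (sym (+-identityʳ j)) eq
  ... | refl = repₖ-injective (trans (sym (code-at j 0 eq)) (trans (agree j ≤-refl) (code-at j 0 eq)))
  code-agree⇒Linked {u} {v} agree j (suc d) eq =
    Linked-descend j d (≤-reflexive (trans (+-comm (suc d) (suc j)) (cong suc eq)))
      (code-agree⇒Linked agree (suc j) d (trans (sym (+-suc j d)) eq))
      (subst (λ i → Linked i (pred^ (suc d) u) (pred^ (suc d) v)) (sym (trans (+-comm (suc d) j) eq)) preds-linked)
    where
      preds-linked : Linked k (pred^ (suc d) u) (pred^ (suc d) v)
      preds-linked = repₖ-injective (trans (sym (code-at j (suc d) eq))
        (trans (agree j (≤-trans (m≤m+n j (suc d)) (≤-reflexive eq))) (code-at j (suc d) eq)))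

  code-injective : ∀ u v → AgreeUpTo k (code u) (code v) → u ≡ v
  code-injective u v agree = Linked-zero (code-agree⇒Linked agree 0 k refl)

  module _ {e : ℕ → Vertex D} (walk : IsEdgeWalk k e) where

    joins : ∀ j → j < k → headNode (e j) ≡ tailNode (e (suc j))
    joins j j<k = node-injective (walk j j<k)

    last-IsRep : ∀ j → j ≡ k → IsRep (e j)
    last-IsRep zero    0≡k = Linked-zero (subst (λ i → Linked i (repₖ (e 0)) (e 0)) (sym 0≡k) (repₖ-~ (e 0)))
    last-IsRep (suc j) j≡k = proj₂ (joins⇒IsRep (joins j (≤-reflexive j≡k)))

    walk-IsRep : ∀ j → j ≤ k → IsRep (e j)
    walk-IsRep j j≤k with m≤n⇒m<n∨m≡n j≤k
    ... | inj₁ j<k = proj₁ (joins⇒IsRep (joins j j<k))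
    ... | inj₂ j≡k = last-IsRep j j≡k

    Realises : ℕ → Vertex D → Set
    Realises j w = ∀ l → l ≤ j → repₖ (pred^ (j ∸ l) w) ≡ e l

    Realises-Linked : ∀ {j w} → j ≤ k → Realises j w → Linked k w (e j)
    Realises-Linked {j} {w} j≤k w↦e = repₖ-injective
      (trans (cong (λ i → repₖ (pred^ i w)) (sym (n∸n≡0 j))) (trans (w↦e j ≤-refl) (sym (walk-IsRep j j≤k))))

    realise : ∀ j → j ≤ k → ∃ (Realises j)
    realise zero    _   = e 0 , λ { zero z≤n → walk-IsRep 0 z≤n }
    realise (suc j) j<k with realise j (<⇒≤ j<k)
    ... | w , w↦e with extend (Linked-suc noSinks (Realises-Linked (<⇒≤ j<k) w↦e) ◅◅ joins⇒Linked (joins j j<k))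
    ... | y , wy , y~e = y , y↦e
      where
        y↦e : Realises (suc j) y
        y↦e l l≤j+1 with m≤n⇒m<n∨m≡n l≤j+1
        ... | inj₁ (s≤s l≤j) = trans (cong (λ i → repₖ (pred^ i y)) (+-∸-assoc 1 l≤j))
            (trans (sym (walk⇒repₖ (suc (j ∸ l)) (≤-trans (s≤s (m∸n≤m j l)) j<k) (pred^-walk (j ∸ l) w ∷ʳ wy)))
                   (w↦e l l≤j))
        ... | inj₂ refl = trans (cong (λ i → repₖ (pred^ i y)) (n∸n≡0 (suc j)))
                                (trans (repₖ-cong y~e) (walk-IsRep (suc j) j<k))

  code-surjective : ∀ e → IsEdgeWalk k e → ∃ λ u → AgreeUpTo k (code u) e
  code-surjective e walk = realise walk k ≤-refl

  overlap⇒joins : ∀ {u v} → Overlap k 1 (code u) (code v) → headNode (repₖ u) ≡ tailNode (repₖ v)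
  overlap⇒joins {u} {v} (_ , vertex=) = subst₂ (λ a b → headNode a ≡ tailNode b) (code-last u) (code-last v)
    (node-injective (trans (vertex= k ≤-refl) (vertices-tail (code-walk v) k ≤-refl)))

  overlap⇒edge : ∀ {u v} → Overlap k 1 (code u) (code v) → Edge D u v
  overlap⇒edge {u} {v} o with extend (Linked-suc noSinks (Linked-sym (repₖ-~ u)) ◅◅ joins⇒Linked (overlap⇒joins o))
  ... | y , uy , y~v = subst (Edge D u) (code-injective y v y≈v) uy
    where
      y≈v : AgreeUpTo k (code y) (code v)
      y≈v j j≤k with m≤n⇒m<n∨m≡n j≤k
      ... | inj₁ j<k  = trans (sym (code-shift uy j j<k)) (proj₁ o j j<k)
      ... | inj₂ refl = trans (code-last y) (trans (repₖ-cong y~v) (trans (repₖ-idempotent v) (sym (code-last v))))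

  model : SequenceModel G D k
  model = record
    { code            = code
    ; code-walk       = code-walk
    ; code-injective  = code-injective
    ; code-surjective = code-surjective
    ; edge⇔overlap    = λ u v → mk⇔ edge⇒overlap overlap⇒edge
    }

theorem9 : (D : Digraph) → NoSources D → NoSinks D → (n : ℕ) → 1 ≤ n →
    IsLineDigraph n D ⇔
      (∀ (i : ℕ) → 1 ≤ i → i ≤ n → (U : Pred (Vertex D) 0ℓ) → IsCoreset D i U →
        ∀ u v → U u → α D i U v → UniqueWalk D i u v)
theorem9 D noSources noSinks (suc k) _ = mk⇔ line⇒unique unique⇒line
  where
    open Walks D

    line⇒unique : IsLineDigraph (suc k) D → CoresetWalksUnique (suc k)
    line⇒unique (_ , _ , _ , _ , D≅LG) = LinkedWalksUnique⇒CoresetWalksUnique noSinks (suc k)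
      (FromSequenceModel.SequenceModel⇒LinkedWalksUnique (≅⇒SequenceModel _ D≅LG))

    unique⇒line : CoresetWalksUnique (suc k) → IsLineDigraph (suc k) D
    unique⇒line unique = _ , _ , _ , _ , SequenceModel⇒≅ G model
      where
        open Construction D noSources noSinks k (CoresetWalksUnique⇒LinkedWalksUnique noSinks (suc k) unique)
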